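{- Let $R$ be a right fountain triangulation of $\mathbb{N}$ with fountain point $0$, let $m$ be a positive integer and let $\mu(R)$ be the mutation of $R$ at the fountain arc $(0,\boldsymbol{y}^R_m)$. Then for all $n\ge 1$, $\boldsymbol{x}^{\mu(R)}_n=\boldsymbol{x}^R_n$ if $n\neq \boldsymbol{y}^R_m-1$, and $\boldsymbol{x}^{\mu(R)}_n=0$ if $n=\boldsymbol{y}^R_m-1$. In particular, the sequences $\boldsymbol{x}^R$ and $\boldsymbol{x}^{\mu(R)}$ differ in exactly one place.
   Context: Arcs are pairs $(a,b)$ of integers with $0\le a<b$; arcs $(a,b),(c,d)$ cross if $a<c<b<d$ or $c<a<d<b$. A triangulation of $\mathbb{N}$ is a maximal set of pairwise noncrossing arcs. A right fountain triangulation with fountain point $0$ is such a triangulation $R$ containing $(0,n)$ for infinitely many $n$. $\boldsymbol{x}^R_n=1$ if $(0,n+1)\in R$ and $\boldsymbol{x}^R_n=0$ otherwise ($n\ge1$); $\boldsymbol{y}^R_n$ is the $(n+1)$-st positive integer $\ell$ with $(0,\ell)\in R$ (so $\boldsymbol{y}^R_0=1$). Mutation at a non-boundary arc $\gamma\in R$: $\gamma$ is the diagonal of a unique quadrilateral formed by two triangles of $R$, and $\mu(R)$ is obtained by replacing $\gamma$ with the other diagonal of that quadrilateral. -}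

module Defs where

open import Data.Nat using (ℕ; zero; suc; _+_; _<_; _≤_)
open import Data.Bool using (Bool; true; false)
open import Data.Product using (Σ; _×_; _,_)
open import Data.Sum using (_⊎_)
open import Relation.Binary.PropositionalEquality using (_≡_)
open import Relation.Nullary using (¬_)

ArcSet : Set
ArcSet = ℕ → ℕ → Bool

_∈ᴿ_ : ℕ × ℕ → ArcSet → Set
(a , b) ∈ᴿ R = R a b ≡ true

Cross : ℕ → ℕ → ℕ → ℕ → Set
Cross a b c d = (a < c × c < b × b < d) ⊎ (c < a × a < d × d < b)

record IsTriangulation (R : ArcSet) : Set where
  field
    arcs        : ∀ a b → (a , b) ∈ᴿ R → a < b
    noncrossing : ∀ a b c d → (a , b) ∈ᴿ R → (c , d) ∈ᴿ R → ¬ Cross a b c d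
    maximal     : ∀ a b → a < b → (∀ c d → (c , d) ∈ᴿ R → ¬ Cross a b c d) → (a , b) ∈ᴿ R

RightFountain0 : ArcSet → Set
RightFountain0 R = ∀ k → Σ ℕ λ n → k < n × (0 , n) ∈ᴿ R

b2n : Bool → ℕ
b2n true  = 1
b2n false = 0

xseq : ArcSet → ℕ → ℕ
xseq R n = b2n (R 0 (suc n))

countFountainBelow : ArcSet → ℕ → ℕ
countFountainBelow R zero = 0
countFountainBelow R (suc zero) = 0
countFountainBelow R (suc (suc k)) = countFountainBelow R (suc k) + b2n (R 0 (suc k))

-- y^R_m ≡ ℓ : ℓ is the (m+1)-st positive integer with (0,ℓ) ∈ R
IsY : ArcSet → ℕ → ℕ → Set
IsY R m ℓ = 1 ≤ ℓ × (0 , ℓ) ∈ᴿ R × countFountainBelow R ℓ ≡ m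

Triangle : ArcSet → ℕ → ℕ → ℕ → Set
Triangle R i j k = i < j × j < k × (i , j) ∈ᴿ R × (j , k) ∈ᴿ R × (i , k) ∈ᴿ R

OtherDiagonal : ArcSet → ℕ → ℕ → ℕ → ℕ → Set
OtherDiagonal R a b p q =
    (a < p × Triangle R a p b × Triangle R a b q)
  ⊎
    (p < a × Triangle R p a b × Triangle R a q b)

IsMutation : ArcSet → ℕ → ℕ → ArcSet → Set
IsMutation R a b R' =
  (a , b) ∈ᴿ R × suc a < b ×
  Σ ℕ λ p → Σ ℕ λ q → OtherDiagonal R a b p q ×
    (∀ u v → ((u , v) ∈ᴿ R' → ((u , v) ∈ᴿ R × ¬ (u ≡ a × v ≡ b)) ⊎ (u ≡ p × v ≡ q))
           × ((((u , v) ∈ᴿ R × ¬ (u ≡ a × v ≡ b)) ⊎ (u ≡ p × v ≡ q)) → (u , v) ∈ᴿ R'))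

{-# OPTIONS --safe #-}
module Submission where

-- Mutating at (a , b) deletes (a , b) and inserts the other diagonal (p , q)
-- of its quadrilateral, for which a < p or p < a, so it does not start at a.
-- Hence among the arcs starting at a exactly (a , b) is lost and nothing is
-- gained.  For a = 0 these arcs are what x records, so x changes only at
-- index ℓ - 1, where it drops from 1 to 0.

open import Defs
open import Data.Nat using (ℕ; _≤_; _∸_; s≤s)
open import Data.Nat.Properties using (<⇒≢; >⇒≢; 0≢1+n)
open import Data.Bool using (false)
open import Data.Bool.Properties using (⇔→≡; ¬-not)
open import Data.Product using (_×_; _,_; proj₁; proj₂)
open import Data.Sum using (inj₁; inj₂)
open import Data.Empty using (⊥-elim)
open import Function.Bundles using (_⇔_; mk⇔; Equivalence)
open import Relation.Binary.PropositionalEquality using (_≡_; _≢_; refl; sym; trans; cong; module ≡-Reasoning)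

otherDiagonal-avoids-source : ∀ {R a b p q} → OtherDiagonal R a b p q → p ≢ a
otherDiagonal-avoids-source (inj₁ (a<p , _)) = >⇒≢ a<p
otherDiagonal-avoids-source (inj₂ (p<a , _)) = <⇒≢ p<a

mutation-arcs-from-source : ∀ {R a b R'} → IsMutation R a b R' →
  ∀ v → (a , v) ∈ᴿ R' ⇔ ((a , v) ∈ᴿ R × v ≢ b)
mutation-arcs-from-source {R} {a} {b} {R'} (_ , _ , _ , _ , diagonal , membership) v =
  mk⇔ to from
  where
  to : (a , v) ∈ᴿ R' → (a , v) ∈ᴿ R × v ≢ b
  to av∈R' with proj₁ (membership a v) av∈R'
  ... | inj₁ (av∈R , av≢ab) = av∈R , λ v≡b → av≢ab (refl , v≡b)
  ... | inj₂ (a≡p , _)      = ⊥-elim (otherDiagonal-avoids-source diagonal (sym a≡p))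

  from : (a , v) ∈ᴿ R × v ≢ b → (a , v) ∈ᴿ R'
  from (av∈R , v≢b) = proj₂ (membership a v) (inj₁ (av∈R , λ (_ , v≡b) → v≢b v≡b))

mutation-keeps-other-arcs-from-source : ∀ {R a b R' v} → IsMutation R a b R' →
  v ≢ b → R' a v ≡ R a v
mutation-keeps-other-arcs-from-source {v = v} μ v≢b = ⇔→≡ (mk⇔
  (λ av∈R' → proj₁ (Equivalence.to (mutation-arcs-from-source μ v) av∈R'))
  (λ av∈R → Equivalence.from (mutation-arcs-from-source μ v) (av∈R , v≢b)))

mutation-removes-arc : ∀ {R a b R'} → IsMutation R a b R' → R' a b ≡ false
mutation-removes-arc {b = b} μ = ¬-not λ ab∈R' →
  proj₂ (Equivalence.to (mutation-arcs-from-source μ b) ab∈R') refl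

xseq-pred : ∀ R {ℓ} → 1 ≤ ℓ → xseq R (ℓ ∸ 1) ≡ b2n (R 0 ℓ)
xseq-pred R (s≤s _) = refl

lemma3p9 : (R : ArcSet) → IsTriangulation R → RightFountain0 R →
    (m : ℕ) → 1 ≤ m → (ℓ : ℕ) → IsY R m ℓ →
    (R' : ArcSet) → IsMutation R 0 ℓ R' →
      (∀ n → 1 ≤ n → n ≢ ℓ ∸ 1 → xseq R' n ≡ xseq R n)
      × xseq R' (ℓ ∸ 1) ≡ 0
      × xseq R' (ℓ ∸ 1) ≢ xseq R (ℓ ∸ 1)
lemma3p9 R _ _ _ _ ℓ (1≤ℓ , 0ℓ∈R , _) R' μ = unchanged , dropped , changed
  where
  unchanged : ∀ n → 1 ≤ n → n ≢ ℓ ∸ 1 → xseq R' n ≡ xseq R n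
  unchanged n _ n≢ℓ∸1 = cong b2n (mutation-keeps-other-arcs-from-source μ
    λ 1+n≡ℓ → n≢ℓ∸1 (cong (_∸ 1) 1+n≡ℓ))

  dropped : xseq R' (ℓ ∸ 1) ≡ 0
  dropped = trans (xseq-pred R' 1≤ℓ) (cong b2n (mutation-removes-arc μ))

  changed : xseq R' (ℓ ∸ 1) ≢ xseq R (ℓ ∸ 1)
  changed x'≡x = 0≢1+n (begin
    0                    ≡⟨ sym dropped ⟩
    xseq R' (ℓ ∸ 1)      ≡⟨ x'≡x ⟩
    xseq R (ℓ ∸ 1)       ≡⟨ xseq-pred R 1≤ℓ ⟩
    b2n (R 0 ℓ)          ≡⟨ cong b2n 0ℓ∈R ⟩
    1                    ∎)
    where open ≡-Reasoning
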